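{- For every unsatisfiable formula $\Gamma$ and every $m\in\mathbb{N}^+$, $\mathrm{size}_{\mathsf{GER}^- }(\mathcal{I}_m(\Gamma))\le \mathrm{size}_{\mathsf{ER}}(\Gamma)$.
   Context: A literal is a variable $v$ or its negation $\bar v$. A clause is a nontautological set of literals; $\bot$ is the empty clause; a formula is a finite set of clauses; $\mathrm{var}(\Gamma)$ is its set of variables. $D$ is a weakening of $C$ if $C\subseteq D$. If $C\cup\{x\}$, $D\cup\{\bar x\}$ are clauses with $x,\bar x\notin C\cup D$ and $C\cup D$ nontautological, $C\cup D$ is their resolvent. For a clause $C$ and formula $\Delta$, $C\vee\Delta=\{C\cup D: D\in\Delta,\ C\cup D \text{ nontautological}\}$. Resolution proof of $\Gamma$: sequence of formulas $(\Gamma_1,\dots,\Gamma_N)$, $\Gamma_1=\Gamma$, $\bot\in\Gamma_N$, each $\Gamma_{i+1}=\Gamma_i\cup\{C\}$ with $C$ a resolvent of two clauses of $\Gamma_i$ or a weakening of a clause of $\Gamma_i$; size $N$. Extended resolution: for a formula $\Delta$, literals $p,q$ and a variable $x$ not occurring in $\Delta,p,q$, $\{\bar x\vee p,\ \bar x\vee q,\ x\vee\bar p\vee\bar q\}$ is a set of extension clauses for $\Delta$. $\Lambda$ is an extension for $\Gamma$ if $\Lambda=\bigcup_{i=1}^t\lambda_i$ with each $\lambda_i$ a set of extension clauses for $\Gamma\cup\lambda_1\cup\dots\cup\lambda_{i-1}$. An $\mathsf{ER}$ proof of $\Gamma$ is a pair $(\Lambda,\Pi)$ with $\Lambda$ an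 extension for $\Gamma$ and $\Pi$ a resolution proof of $\Gamma\cup\Lambda$; size $|\Lambda|+|\Pi|$. $\mathrm{size}_{P}(\Gamma)$ denotes the minimum size of a $P$-proof of $\Gamma$. Blocked clause: $C=\{p\}\cup C'$ ($p\notin C'$) is blocked for $p$ w.r.t. $\Gamma$ if for every $\{\bar p\}\cup D'\in\Gamma$ ($\bar p\notin D'$), $C'\cup D'$ is tautological; $C$ is blocked w.r.t. $\Gamma$ if blocked for some $p\in C$. A formula $\Lambda$ is a blocked extension for $\Gamma$ if there is $\Gamma'\subseteq\Gamma$ and an ordering $(C_1,\dots,C_r)$ of all clauses of $\Lambda\cup(\Gamma\setminus\Gamma')$ such that each $C_i$ is blocked w.r.t. $\Gamma'\cup\{C_1,\dots,C_{i-1}\}$. A $\mathsf{GER}$ proof of $\Gamma$ is a pair $(\Lambda,\Pi)$ with $\Lambda$ a blocked extension for $\Gamma$ and $\Pi$ a resolution proof of $\Gamma\cup\Lambda$; size $|\Lambda|+|\Pi|$. A $\mathsf{GER}^-$ proof of $\Gamma$ is a $\mathsf{GER}$ proof all of whose variables (in both $\Lambda$ and $\Pi$) lie in $\mathrm{var}(\Gamma)$. Construction: for unsatisfiable $\Gamma$, fix a minimum-size $\mathsf{ER}$ proof $(\Lambda,\Pi)$ of $\Gamma$, $\Lambda$ being the union of $t(\Gamma)=|\Lambda|/3$ sets $\lambda_i=\{\bar x_i\vee p_i,\ \bar x_i\vee q_i,\ x_i\vee\bar p_i\vee\bar q_i\}$ with extension variables $x_1,\dots,x_{t(\Gamma)}$,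 where the variables of $p_i,q_i$ lie in $\mathrm{var}(\Gamma)\cup\{x_1,\dots,x_{i-1}\}$. For $m\in\mathbb{N}^+$ let $y_1,\dots,y_m,z_1,\dots,z_m$ be $2m$ distinct variables not in $\mathrm{var}(\Gamma\cup\Lambda)$, and define $V_m(\Gamma)=\bigcup_{i=1}^{t(\Gamma)}\bigcup_{j=1}^m\{x_i\vee y_j\vee\bar z_j,\ \bar x_i\vee y_j\vee\bar z_j\}$, $W_m(\Gamma)=\bigcup_{j=1}^m\big[\{\bar y_j\vee z_j\}\cup(y_j\vee\Gamma)\cup(\bar z_j\vee\Gamma)\big]$, $\mathcal{I}_m(\Gamma)=\Gamma\cup V_m(\Gamma)\cup W_m(\Gamma)$. -}

module Defs where

open import Data.Nat using (ℕ; suc; _+_; _*_; _≤_)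
open import Data.Fin using (Fin)
open import Data.Bool using (Bool; true; false; not)
open import Data.List using (List; []; _∷_; length; concatMap)
open import Data.List.Membership.Propositional using (_∈_; _∉_)
open import Data.List.Relation.Binary.Subset.Propositional using (_⊆_)
open import Data.List.Relation.Unary.Any using (Any)
open import Data.List.Relation.Unary.All using (All)
open import Data.List.Relation.Unary.AllPairs using (AllPairs)
open import Data.Product using (Σ; ∃; ∃-syntax; _×_; _,_)
open import Data.Sum using (_⊎_)
open import Data.Unit using (⊤)
open import Data.Empty using (⊥)
open import Relation.Nullary using (¬_)
open import Relation.Binary.PropositionalEquality using (_≡_; _≢_)
open import Function.Bundles using (_⇔_)

data Lit : Set where
  pos : ℕ → Lit
  neg : ℕ → Lit

var : Lit → ℕ
var (pos v) = v
var (neg v) = v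

~_ : Lit → Lit
~ pos v = neg v
~ neg v = pos v

-- A clause is a finite set of literals, represented by a list
-- (order and repetitions irrelevant: clauses are compared with _≋_).
Clause : Set
Clause = List Lit

_≋_ : Clause → Clause → Set
C ≋ D = (C ⊆ D) × (D ⊆ C)

Taut : Clause → Set
Taut C = ∃[ v ] (pos v ∈ C × neg v ∈ C)

NonTaut : Clause → Set
NonTaut C = ¬ Taut C

-- A formula is a set of clauses, given by its membership predicate
-- (always closed under _≋_ in our constructions).
Formula : Set₁
Formula = Clause → Set

⟦_⟧ : List Clause → Formula
⟦ Γ ⟧ C = Any (C ≋_) Γ

infixr 6 _∪F_
_∪F_ : Formula → Formula → Formula
(Δ ∪F Δ') C = Δ C ⊎ Δ' C

ins : Clause → Formula → Formula
ins C Δ E = (E ≋ C) ⊎ Δ E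

OccC : ℕ → Clause → Set
OccC v C = Any (λ l → var l ≡ v) C

VarF : Formula → ℕ → Set
VarF Δ v = ∃[ C ] (Δ C × OccC v C)

OccL : ℕ → List Clause → Set
OccL v Γ = Any (OccC v) Γ

litVal : (ℕ → Bool) → Lit → Bool
litVal α (pos v) = α v
litVal α (neg v) = not (α v)

SatClause : (ℕ → Bool) → Clause → Set
SatClause α C = Any (λ l → litVal α l ≡ true) C

Unsatisfiable : List Clause → Set
Unsatisfiable Γ = ∀ (α : ℕ → Bool) → ¬ All (SatClause α) Γ

Resolvent : Clause → Clause → Clause → Set
Resolvent E₁ E₂ R =
  ∃[ C ] ∃[ D ] ∃[ x ]
    ( (E₁ ≋ (x ∷ C)) × (E₂ ≋ ((~ x) ∷ D))
    × (x ∉ C) × (x ∉ D) × ((~ x) ∉ C) × ((~ x) ∉ D)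
    × NonTaut (Data.List._++_ C D)
    × (R ≋ Data.List._++_ C D) )

-- D is a weakening of C (D must itself be a clause)
Weakening : Clause → Clause → Set
Weakening C D = (C ⊆ D) × NonTaut D

Step : Formula → Clause → Set
Step Δ R =
  (∃[ E₁ ] ∃[ E₂ ] (Δ E₁ × Δ E₂ × Resolvent E₁ E₂ R))
  ⊎ (∃[ E ] (Δ E × Weakening E R))

Steps : Formula → List Clause → Set
Steps Δ []       = ⊤
Steps Δ (R ∷ Rs) = Step Δ R × Steps (ins R Δ) Rs

-- A resolution proof (Γ₁,…,Γ_N) of Δ, given by the list of added
-- clauses (N = 1 + number of added clauses).
record ResProof (Δ : Formula) : Set where
  field
    added    : List Clause
    valid    : Steps Δ added
    refutes  : (Δ ∪F ⟦ added ⟧) []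

resSize : ∀ {Δ} → ResProof Δ → ℕ
resSize P = suc (length (ResProof.added P))

ExtTriple : Set
ExtTriple = ℕ × Lit × Lit

extClauses : ExtTriple → List Clause
extClauses (x , p , q) =
  (neg x ∷ p ∷ []) ∷ (neg x ∷ q ∷ []) ∷ (pos x ∷ (~ p) ∷ (~ q) ∷ []) ∷ []

extAll : List ExtTriple → List Clause
extAll = concatMap extClauses

IsExtSet : Formula → ExtTriple → Set
IsExtSet Δ (x , p , q) =
  ¬ VarF Δ x × (x ≢ var p) × (x ≢ var q)
  × NonTaut (pos x ∷ (~ p) ∷ (~ q) ∷ [])

ValidExt : Formula → List ExtTriple → Set
ValidExt Δ []       = ⊤
ValidExt Δ (e ∷ es) = IsExtSet Δ e × ValidExt (Δ ∪F ⟦ extClauses e ⟧) es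

record ERProof (Γ : List Clause) : Set where
  field
    ext      : List ExtTriple
    extValid : ValidExt ⟦ Γ ⟧ ext
    proof    : ResProof (⟦ Γ ⟧ ∪F ⟦ extAll ext ⟧)

-- |Λ| + |Π|; the 3t extension clauses are pairwise distinct
erSize : ∀ {Γ} → ERProof Γ → ℕ
erSize P = 3 * length (ERProof.ext P) + resSize (ERProof.proof P)

ExtVarsOK : (ℕ → Set) → List ExtTriple → Set
ExtVarsOK S []                = ⊤
ExtVarsOK S ((x , p , q) ∷ es) =
  S (var p) × S (var q) × ExtVarsOK (λ v → v ≡ x ⊎ S v) es

InMinus : Lit → Clause → Lit → Set
InMinus a C l = (a ∈ C) × (a ≢ l)

TautRes : Clause → Lit → Clause → Set
TautRes C p E =
  ∃[ v ] ( (InMinus (pos v) C p ⊎ InMinus (pos v) E (~ p))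
         × (InMinus (neg v) C p ⊎ InMinus (neg v) E (~ p)) )

BlockedFor : Lit → Clause → Formula → Set
BlockedFor p C Δ = (p ∈ C) × (∀ E → Δ E → (~ p) ∈ E → TautRes C p E)

Blocked : Clause → Formula → Set
Blocked C Δ = ∃[ p ] BlockedFor p C Δ

BlockedSeq : Formula → List Clause → Set
BlockedSeq S []       = ⊤
BlockedSeq S (C ∷ Cs) = Blocked C S × BlockedSeq (ins C S) Cs

BlockedExt : Formula → List Clause → Set₁
BlockedExt Δ Λ =
  Σ Formula λ Δ' → (∀ C → Δ' C → Δ C) ×
  Σ (List Clause) λ L →
    AllPairs (λ C D → ¬ (C ≋ D)) L ×
    (∀ C → ⟦ L ⟧ C ⇔ (⟦ Λ ⟧ C ⊎ (Δ C × ¬ Δ' C))) ×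
    BlockedSeq Δ' L

record GERminusProof (Δ : Formula) : Set₁ where
  field
    Λ         : List Clause
    Λclauses  : All NonTaut Λ
    Λdistinct : AllPairs (λ C D → ¬ (C ≋ D)) Λ
    blocked   : BlockedExt Δ Λ
    proof     : ResProof (Δ ∪F ⟦ Λ ⟧)
    varsΛ     : ∀ C → C ∈ Λ → ∀ v → OccC v C → VarF Δ v
    varsΠ     : ∀ C → C ∈ ResProof.added proof → ∀ v → OccC v C → VarF Δ v

gerSize : ∀ {Δ} → GERminusProof Δ → ℕ
gerSize Q = length (GERminusProof.Λ Q) + resSize (GERminusProof.proof Q)

V-F : ∀ {m} → List ExtTriple → (Fin m → ℕ) → (Fin m → ℕ) → Formula
V-F ext y z C =
  Any (λ { (x , _ , _) → ∃[ j ]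
         ( (C ≋ (pos x ∷ pos (y j) ∷ neg (z j) ∷ []))
         ⊎ (C ≋ (neg x ∷ pos (y j) ∷ neg (z j) ∷ [])) ) }) ext

OrF : Lit → List Clause → Formula
OrF ℓ Γ C = ∃[ D ] ((D ∈ Γ) × NonTaut (ℓ ∷ D) × (C ≋ (ℓ ∷ D)))

W-F : ∀ {m} → List Clause → (Fin m → ℕ) → (Fin m → ℕ) → Formula
W-F Γ y z C = ∃[ j ]
  ( (C ≋ (neg (y j) ∷ pos (z j) ∷ []))
  ⊎ OrF (pos (y j)) Γ C
  ⊎ OrF (neg (z j)) Γ C )

I-F : ∀ {m} → List Clause → List ExtTriple → (Fin m → ℕ) → (Fin m → ℕ) → Formula
I-F Γ ext y z = ⟦ Γ ⟧ ∪F V-F ext y z ∪F W-F Γ y z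

-- The extension clauses of the ER proof, listed triple by triple, are blocked with respect to
-- Γ ∪ W, since each extension variable is fresh when its triple is added.  The V-clauses
-- x ∨ y_j ∨ z̄_j and x̄ ∨ y_j ∨ z̄_j are then blocked on y_j, because ȳ_j occurs only in
-- ȳ_j ∨ z_j, which clashes on z_j.  So Λ is a blocked extension of I_m(Γ) with Γ' = Γ ∪ W, and
-- the V-clauses put every extension variable into var(I_m(Γ)).  The refutation Π is reused after
-- deleting from every clause the literals over variables outside var(Γ ∪ Λ): resolution on such a
-- variable becomes a weakening, so the result is a GER⁻ proof with at most |Λ| + |Π| lines.

module Submission where

open import Defs
open import Data.Nat using (ℕ; suc; _+_; _*_; _≤_; s≤s; z≤n; _≟_)
import Data.Nat.Properties as ℕ
open import Data.Fin using (Fin; zero)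
open import Data.List using (List; []; _∷_; _++_; length; filter; map; concatMap; allFin)
open import Data.List.Properties using (filter-++; length-++; length-map)
open import Data.List.Membership.Propositional using (_∈_; _∉_; find; lose)
open import Data.List.Membership.Propositional.Properties using (∈-filter⁺; ∈-filter⁻; ∈-allFin; ∈-map⁻)
open import Data.List.Relation.Binary.Subset.Propositional using (_⊆_)
open import Data.List.Relation.Binary.Subset.Propositional.Properties using (⊆-refl; ⊆-trans; Any-resp-⊆; xs⊆xs++ys)
open import Data.List.Relation.Unary.Any as Any using (Any; here; there; any?)
import Data.List.Relation.Unary.Any.Properties as Any
open import Data.List.Relation.Unary.All as All using (All; []; _∷_)
import Data.List.Relation.Unary.All.Properties as All
open import Data.List.Relation.Unary.AllPairs using (AllPairs; []; _∷_)
import Data.List.Relation.Unary.AllPairs.Properties as AllPairs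
open import Data.Product using (Σ; ∃-syntax; _×_; _,_; proj₁; proj₂)
open import Data.Sum using (_⊎_; inj₁; inj₂)
open import Data.Unit using (tt)
open import Data.Empty using (⊥-elim)
open import Relation.Nullary using (¬_; Dec; yes; no)
open import Relation.Nullary.Decidable using (map′; _×-dec_)
open import Relation.Unary using (Decidable)
open import Relation.Binary.Definitions using (DecidableEquality)
open import Relation.Binary.PropositionalEquality using (_≡_; _≢_; refl; sym; trans; cong; subst)
open import Function.Bundles using (_⇔_; mk⇔)
open import Function.Definitions using (Injective)

~-involutive : ∀ l → ~ (~ l) ≡ l
~-involutive (pos v) = refl
~-involutive (neg v) = refl

var-~ : ∀ l → var (~ l) ≡ var l
var-~ (pos v) = refl
var-~ (neg v) = refl

_≟ˡ_ : DecidableEquality Lit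
pos a ≟ˡ pos b = map′ (cong pos) (λ { refl → refl }) (a ≟ b)
pos a ≟ˡ neg b = no λ ()
neg a ≟ˡ pos b = no λ ()
neg a ≟ˡ neg b = map′ (cong neg) (λ { refl → refl }) (a ≟ b)

open import Data.List.Relation.Binary.Subset.DecPropositional _≟ˡ_ using (_⊆?_)

≋-refl : ∀ {C} → C ≋ C
≋-refl = ⊆-refl , ⊆-refl

≋-trans : ∀ {C D E} → C ≋ D → D ≋ E → C ≋ E
≋-trans (C⊆D , D⊆C) (D⊆E , E⊆D) = ⊆-trans C⊆D D⊆E , ⊆-trans E⊆D D⊆C

_≋?_ : ∀ C D → Dec (C ≋ D)
C ≋? D = (C ⊆? D) ×-dec (D ⊆? C)

NonTaut-⊆ : ∀ {C D} → C ⊆ D → NonTaut D → NonTaut C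
NonTaut-⊆ C⊆D nt (v , p , n) = nt (v , C⊆D p , C⊆D n)

∈⇒⟦⟧ : ∀ {C Cs} → C ∈ Cs → ⟦ Cs ⟧ C
∈⇒⟦⟧ C∈ = lose C∈ ≋-refl

infix 4 _⊆ᶠ_
_⊆ᶠ_ : Formula → Formula → Set
Δ ⊆ᶠ Δ' = ∀ {C} → Δ C → Δ' C

VarsWithin : Formula → (ℕ → Set) → Set
VarsWithin Δ U = ∀ {C v} → Δ C → OccC v C → U v

Distinct : List Clause → Set
Distinct = AllPairs (λ C D → ¬ C ≋ D)

dedup : List Clause → List Clause
dedup [] = []
dedup (C ∷ Cs) with any? (C ≋?_) (dedup Cs)
... | yes _ = dedup Cs
... | no  _ = C ∷ dedup Cs

⟦dedup⟧⁺ : ∀ Cs → ⟦ Cs ⟧ ⊆ᶠ ⟦ dedup Cs ⟧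
⟦dedup⟧⁺ (C ∷ Cs) (here E≋C) with any? (C ≋?_) (dedup Cs)
... | yes C∈ = Any.map (≋-trans E≋C) C∈
... | no  _  = here E≋C
⟦dedup⟧⁺ (C ∷ Cs) (there E∈) with any? (C ≋?_) (dedup Cs)
... | yes _ = ⟦dedup⟧⁺ Cs E∈
... | no  _ = there (⟦dedup⟧⁺ Cs E∈)

⟦dedup⟧⁻ : ∀ Cs → ⟦ dedup Cs ⟧ ⊆ᶠ ⟦ Cs ⟧
⟦dedup⟧⁻ (C ∷ Cs) E∈ with any? (C ≋?_) (dedup Cs)
⟦dedup⟧⁻ (C ∷ Cs) E∈         | yes _ = there (⟦dedup⟧⁻ Cs E∈)
⟦dedup⟧⁻ (C ∷ Cs) (here E≋C) | no  _ = here E≋C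
⟦dedup⟧⁻ (C ∷ Cs) (there E∈) | no  _ = there (⟦dedup⟧⁻ Cs E∈)

All-dedup : ∀ {Q : Clause → Set} Cs → All Q Cs → All Q (dedup Cs)
All-dedup [] [] = []
All-dedup (C ∷ Cs) (q ∷ qs) with any? (C ≋?_) (dedup Cs)
... | yes _ = All-dedup Cs qs
... | no  _ = q ∷ All-dedup Cs qs

dedup-distinct : ∀ Cs → Distinct (dedup Cs)
dedup-distinct [] = []
dedup-distinct (C ∷ Cs) with any? (C ≋?_) (dedup Cs)
... | yes _  = dedup-distinct Cs
... | no  C∉ = All.¬Any⇒All¬ (dedup Cs) C∉ ∷ dedup-distinct Cs

length-dedup : ∀ Cs → length (dedup Cs) ≤ length Cs
length-dedup [] = z≤n
length-dedup (C ∷ Cs) with any? (C ≋?_) (dedup Cs)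
... | yes _ = ℕ.m≤n⇒m≤1+n (length-dedup Cs)
... | no  _ = s≤s (length-dedup Cs)

ins⇒∪⟦∷⟧ : ∀ {C Δ Cs} → ins C Δ ∪F ⟦ Cs ⟧ ⊆ᶠ Δ ∪F ⟦ C ∷ Cs ⟧
ins⇒∪⟦∷⟧ (inj₁ (inj₁ E≋C)) = inj₂ (here E≋C)
ins⇒∪⟦∷⟧ (inj₁ (inj₂ E∈Δ)) = inj₁ E∈Δ
ins⇒∪⟦∷⟧ (inj₂ E∈Cs)       = inj₂ (there E∈Cs)

∪⟦∷⟧⇒ins : ∀ {C Δ Cs} → Δ ∪F ⟦ C ∷ Cs ⟧ ⊆ᶠ ins C Δ ∪F ⟦ Cs ⟧
∪⟦∷⟧⇒ins (inj₁ E∈Δ)          = inj₁ (inj₂ E∈Δ)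
∪⟦∷⟧⇒ins (inj₂ (here E≋C))   = inj₁ (inj₁ E≋C)
∪⟦∷⟧⇒ins (inj₂ (there E∈Cs)) = inj₂ E∈Cs

module Restriction (Keep : Lit → Set) (keep? : Decidable Keep)
                   (Keep-~ : ∀ l → Keep l → Keep (~ l)) where

  restrict : Clause → Clause
  restrict = filter keep?

  restrict-⊆ : ∀ C → restrict C ⊆ C
  restrict-⊆ C l∈ = proj₁ (∈-filter⁻ keep? l∈)

  restrict-mono : ∀ {C D} → C ⊆ D → restrict C ⊆ restrict D
  restrict-mono C⊆D l∈ with ∈-filter⁻ keep? l∈
  ... | l∈C , kl = ∈-filter⁺ keep? (C⊆D l∈C) kl

  restrict-≋ : ∀ {C D} → C ≋ D → restrict C ≋ restrict D
  restrict-≋ (C⊆D , D⊆C) = restrict-mono C⊆D , restrict-mono D⊆C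

  restrict-id : ∀ {C} → All Keep C → restrict C ≋ C
  restrict-id {C} keepC = restrict-⊆ C , λ l∈ → ∈-filter⁺ keep? l∈ (All.lookup keepC l∈)

  restrict-∷ : ∀ {F l G} → F ≋ (l ∷ G) → Keep l → restrict F ≋ (l ∷ restrict G)
  restrict-∷ {F} {l} {G} (F⊆ , ⊆F) kl = to , from
    where
    to : restrict F ⊆ l ∷ restrict G
    to l'∈ with ∈-filter⁻ keep? l'∈
    ... | l'∈F , kl' with F⊆ l'∈F
    ... | here l'≡l   = here l'≡l
    ... | there l'∈G = there (∈-filter⁺ keep? l'∈G kl')
    from : l ∷ restrict G ⊆ restrict F
    from (here refl) = ∈-filter⁺ keep? (⊆F (here refl)) kl
    from (there l'∈) with ∈-filter⁻ keep? l'∈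
    ... | l'∈G , kl' = ∈-filter⁺ keep? (⊆F (there l'∈G)) kl'

  restrict-weakening : ∀ {E R} → Weakening E R → Weakening (restrict E) (restrict R)
  restrict-weakening {R = R} (E⊆R , nt) = restrict-mono E⊆R , NonTaut-⊆ (restrict-⊆ R) nt

  pivot : ∀ {E₁ E₂ R} → Resolvent E₁ E₂ R → Lit
  pivot (_ , _ , x , _) = x

  restrict-resolvent : ∀ {E₁ E₂ R} (r : Resolvent E₁ E₂ R) → Keep (pivot r) →
                       Resolvent (restrict E₁) (restrict E₂) (restrict R)
  restrict-resolvent {R = R} (C , D , x , E₁≋ , E₂≋ , x∉C , x∉D , x̄∉C , x̄∉D , nt , R≋) kx =
    restrict C , restrict D , x , restrict-∷ E₁≋ kx , restrict-∷ E₂≋ (Keep-~ x kx) ,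
    (λ x∈ → x∉C (restrict-⊆ C x∈)) , (λ x∈ → x∉D (restrict-⊆ D x∈)) ,
    (λ x̄∈ → x̄∉C (restrict-⊆ C x̄∈)) , (λ x̄∈ → x̄∉D (restrict-⊆ D x̄∈)) ,
    NonTaut-⊆ (subst (λ X → X ⊆ C ++ D) (filter-++ keep? C D) (restrict-⊆ (C ++ D))) nt ,
    subst (restrict R ≋_) (filter-++ keep? C D) (restrict-≋ R≋)

  -- When the pivot is dropped, the restricted first premise is already contained in the
  -- restricted resolvent, so resolution degenerates into weakening.
  resolvent-weakening : ∀ {E₁ E₂ R} (r : Resolvent E₁ E₂ R) → ¬ Keep (pivot r) →
                        Weakening (restrict E₁) (restrict R)
  resolvent-weakening {E₁} {R = R} (C , D , x , (E₁⊆ , _) , _ , _ , _ , _ , _ , nt , (R⊆ , C++D⊆R)) ¬kx =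
    E₁⊆R , NonTaut-⊆ (⊆-trans (restrict-⊆ R) R⊆) nt
    where
    E₁⊆R : restrict E₁ ⊆ restrict R
    E₁⊆R l∈ with ∈-filter⁻ keep? l∈
    ... | l∈E₁ , kl with E₁⊆ l∈E₁
    ... | here refl  = ⊥-elim (¬kx kl)
    ... | there l∈C = ∈-filter⁺ keep? (C++D⊆R (xs⊆xs++ys C D l∈C)) kl

  Embeds : Formula → Formula → Set
  Embeds Δ Δ' = ∀ {E} → Δ E → Δ' (restrict E)

  restrict-step : ∀ {Δ Δ' R} → Embeds Δ Δ' → Step Δ R → Step Δ' (restrict R)
  restrict-step emb (inj₂ (E , E∈ , w)) = inj₂ (restrict E , emb E∈ , restrict-weakening w)
  restrict-step emb (inj₁ (E₁ , E₂ , E₁∈ , E₂∈ , r)) with keep? (pivot r)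
  ... | yes kx = inj₁ (restrict E₁ , restrict E₂ , emb E₁∈ , emb E₂∈ , restrict-resolvent r kx)
  ... | no ¬kx = inj₂ (restrict E₁ , emb E₁∈ , resolvent-weakening r ¬kx)

  restrict-steps : ∀ {Δ Δ'} Rs → Embeds Δ Δ' → Steps Δ Rs →
                   Steps Δ' (map restrict Rs) × Embeds (Δ ∪F ⟦ Rs ⟧) (Δ' ∪F ⟦ map restrict Rs ⟧)
  restrict-steps [] emb tt = tt , λ { (inj₁ E∈) → inj₁ (emb E∈) ; (inj₂ ()) }
  restrict-steps {Δ} {Δ'} (R ∷ Rs) emb (s , ss) with restrict-steps Rs ins-emb ss
    where
    ins-emb : Embeds (ins R Δ) (ins (restrict R) Δ')
    ins-emb (inj₁ E≋R) = inj₁ (restrict-≋ E≋R)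
    ins-emb (inj₂ E∈)  = inj₂ (emb E∈)
  ... | ss' , emb' =
    (restrict-step emb s , ss') , λ E∈ → ins⇒∪⟦∷⟧ {Δ = Δ'} (emb' (∪⟦∷⟧⇒ins {Δ = Δ} E∈))

  restrict-proof : ∀ {Δ Δ'} → Embeds Δ Δ' → ResProof Δ → ResProof Δ'
  restrict-proof emb Π = record
    { added   = map restrict (ResProof.added Π)
    ; valid   = proj₁ steps
    ; refutes = proj₂ steps (ResProof.refutes Π) }
    where steps = restrict-steps (ResProof.added Π) emb (ResProof.valid Π)

tautRes-complementary : ∀ {C E l} a → InMinus a C l → InMinus (~ a) E (~ l) → TautRes C l E
tautRes-complementary (pos v) a∈C ā∈E = v , inj₁ a∈C , inj₂ ā∈E
tautRes-complementary (neg v) a∈C ā∈E = v , inj₂ ā∈E , inj₁ a∈C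

BlockedSeq-++ : ∀ {S} A {B} → BlockedSeq S A →
                (∀ {S'} → S' ⊆ᶠ S ∪F ⟦ A ⟧ → BlockedSeq S' B) → BlockedSeq S (A ++ B)
BlockedSeq-++ []      tt       k = k inj₁
BlockedSeq-++ {S} (C ∷ A) (b , bs) k =
  b , BlockedSeq-++ A bs λ S'⊆ → k λ E∈ → ins⇒∪⟦∷⟧ {Δ = S} (S'⊆ E∈)

BlockedSeq-invariant : ∀ (Inv : Formula → Set) {Q : Clause → Set} →
                       (∀ {C T} → Q C → Inv T → Blocked C T) →
                       (∀ {C T} → Q C → Inv T → Inv (ins C T)) →
                       ∀ {T} Cs → All Q Cs → Inv T → BlockedSeq T Cs
BlockedSeq-invariant Inv blocked preserved []       []       inv = tt
BlockedSeq-invariant Inv blocked preserved (C ∷ Cs) (q ∷ qs) inv =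
  blocked q inv , BlockedSeq-invariant Inv blocked preserved Cs qs (preserved q inv)

extVar-occurs-∈ : ∀ {x p q C} → C ∈ extClauses (x , p , q) → OccC x C
extVar-occurs-∈ (here refl)                 = here refl
extVar-occurs-∈ (there (here refl))         = here refl
extVar-occurs-∈ (there (there (here refl))) = here refl

occ-extClauses : ∀ {v x p q} → OccL v (extClauses (x , p , q)) → v ≡ x ⊎ v ≡ var p ⊎ v ≡ var q
occ-extClauses (here (here e))                               = inj₁ (sym e)
occ-extClauses (here (there (here e)))                       = inj₂ (inj₁ (sym e))
occ-extClauses (there (here (here e)))                       = inj₁ (sym e)
occ-extClauses (there (here (there (here e))))               = inj₂ (inj₂ (sym e))
occ-extClauses (there (there (here (here e))))               = inj₁ (sym e)
occ-extClauses {p = p} (there (there (here (there (here e))))) = inj₂ (inj₁ (trans (sym e) (var-~ p)))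
occ-extClauses {q = q} (there (there (here (there (there (here e)))))) = inj₂ (inj₂ (trans (sym e) (var-~ q)))

extVar-occurs : ∀ es {t} → t ∈ es → OccL (proj₁ t) (extAll es)
extVar-occurs (e ∷ es) (here refl) = Any.++⁺ˡ {xs = extClauses e} (here (here refl))
extVar-occurs (e ∷ es) (there t∈) = Any.++⁺ʳ (extClauses e) (extVar-occurs es t∈)

⟦extAll⟧⇒extVar : ∀ es {C} → ⟦ extAll es ⟧ C → ∃[ t ] (t ∈ es × OccC (proj₁ t) C)
⟦extAll⟧⇒extVar (e ∷ es) C∈ with Any.++⁻ (extClauses e) C∈
... | inj₁ C∈e with find C∈e
...   | F , F∈e , (_ , F⊆C) = e , here refl , Any-resp-⊆ F⊆C (extVar-occurs-∈ F∈e)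
⟦extAll⟧⇒extVar (e ∷ es) C∈ | inj₂ C∈es with ⟦extAll⟧⇒extVar es C∈es
... | t , t∈ , x∈C = t , there t∈ , x∈C

occ-extAll : ∀ {S U : ℕ → Set} es → ExtVarsOK S es → (∀ {v} → S v → U v) →
             (∀ {t} → t ∈ es → U (proj₁ t)) → ∀ {v} → OccL v (extAll es) → U v
occ-extAll ((x , p , q) ∷ es) (Sp , Sq , ok) S⇒U extVar⇒U v∈ with Any.++⁻ (extClauses (x , p , q)) v∈
... | inj₂ v∈es = occ-extAll es ok (λ { (inj₁ refl) → extVar⇒U (here refl) ; (inj₂ Sv) → S⇒U Sv })
                             (λ t∈ → extVar⇒U (there t∈)) v∈es
... | inj₁ v∈e with occ-extClauses v∈e
...   | inj₁ refl        = extVar⇒U (here refl)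
...   | inj₂ (inj₁ refl) = S⇒U Sp
...   | inj₂ (inj₂ refl) = S⇒U Sq

ValidExt-fresh : ∀ {Δ} es → ValidExt Δ es → ∀ {t} → t ∈ es → ¬ VarF Δ (proj₁ t)
ValidExt-fresh (e ∷ es) ((x∉Δ , _) , _)  (here refl) = x∉Δ
ValidExt-fresh (e ∷ es) (_ , valid) (there t∈) (C , C∈Δ , x∈C) =
  ValidExt-fresh es valid t∈ (C , inj₁ C∈Δ , x∈C)

NonTaut-extClauses : ∀ {Δ} e → IsExtSet Δ e → All NonTaut (extClauses e)
NonTaut-extClauses (x , p , q) (_ , x≢p , x≢q , nt) = binary x≢p ∷ binary x≢q ∷ nt ∷ []
  where
  binary : ∀ {l} → x ≢ var l → NonTaut (neg x ∷ l ∷ [])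
  binary x≢l (v , there (here refl) , here refl)         = x≢l refl
  binary x≢l (v , there (here refl) , there (here ()))

-- For p = q the first two extension clauses coincide, while Λ must be listed without repetition.
dedupExt : List ExtTriple → List Clause
dedupExt = concatMap (λ e → dedup (extClauses e))

⟦dedupExt⟧⁺ : ∀ es → ⟦ extAll es ⟧ ⊆ᶠ ⟦ dedupExt es ⟧
⟦dedupExt⟧⁺ (e ∷ es) C∈ with Any.++⁻ (extClauses e) C∈
... | inj₁ C∈e  = Any.++⁺ˡ (⟦dedup⟧⁺ (extClauses e) C∈e)
... | inj₂ C∈es = Any.++⁺ʳ (dedup (extClauses e)) (⟦dedupExt⟧⁺ es C∈es)

⟦dedupExt⟧⁻ : ∀ es → ⟦ dedupExt es ⟧ ⊆ᶠ ⟦ extAll es ⟧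
⟦dedupExt⟧⁻ (e ∷ es) C∈ with Any.++⁻ (dedup (extClauses e)) C∈
... | inj₁ C∈e  = Any.++⁺ˡ (⟦dedup⟧⁻ (extClauses e) C∈e)
... | inj₂ C∈es = Any.++⁺ʳ (extClauses e) (⟦dedupExt⟧⁻ es C∈es)

NonTaut-dedupExt : ∀ {Δ} es → ValidExt Δ es → All NonTaut (dedupExt es)
NonTaut-dedupExt []       _                 = []
NonTaut-dedupExt (e ∷ es) (isExt , valid) =
  All.++⁺ (All-dedup (extClauses e) (NonTaut-extClauses e isExt)) (NonTaut-dedupExt es valid)

-- A clause of a later triple contains that triple's variable, which is fresh for the earlier ones.
dedupExt-distinct : ∀ {Δ} es → ValidExt Δ es → Distinct (dedupExt es)
dedupExt-distinct []       _           = []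
dedupExt-distinct (e ∷ es) (_ , valid) =
  AllPairs.++⁺ (dedup-distinct (extClauses e)) (dedupExt-distinct es valid)
    (All.tabulate λ {C} C∈ → All.tabulate λ D∈ C≋D →
      let t , t∈ , x∈D = ⟦extAll⟧⇒extVar es (⟦dedupExt⟧⁻ es (∈⇒⟦⟧ D∈))
      in ValidExt-fresh es valid t∈
           (C , inj₂ (⟦dedup⟧⁻ (extClauses e) (∈⇒⟦⟧ C∈)) , Any-resp-⊆ (proj₂ C≋D) x∈D))

length-dedupExt : ∀ es → length (dedupExt es) ≤ 3 * length es
length-dedupExt []       = z≤n
length-dedupExt (e ∷ es) = begin
  length (dedup (extClauses e) ++ dedupExt es)
    ≡⟨ length-++ (dedup (extClauses e)) ⟩
  length (dedup (extClauses e)) + length (dedupExt es)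
    ≤⟨ ℕ.+-mono-≤ (length-dedup (extClauses e)) (length-dedupExt es) ⟩
  3 + 3 * length es
    ≡⟨ ℕ.*-suc 3 (length es) ⟨
  3 * length (e ∷ es) ∎
  where open ℕ.≤-Reasoning

module ExtensionTriple (x : ℕ) (p q : Lit) (x≢p : x ≢ var p) (x≢q : x ≢ var q) where

  Confined : Formula → Set
  Confined T = ∀ {E} → T E → OccC x E → ⟦ extClauses (x , p , q) ⟧ E

  private
    x≢~ : ∀ l → x ≢ var l → x ≢ var (~ l)
    x≢~ l = subst (x ≢_) (sym (var-~ l))

    ≢-x : ∀ {l a} → x ≢ var l → var a ≡ x → l ≢ a
    ≢-x x≢l va≡x refl = x≢l (sym va≡x)

  blocked-x̄∨l : ∀ {C T l} → x ≢ var l → ~ l ∈ (~ p ∷ ~ q ∷ []) → C ≋ (neg x ∷ l ∷ []) →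
                Confined T → Blocked C T
  blocked-x̄∨l {C} {T} {l} x≢l l̄∈ (_ , ⊇C) confined =
    neg x , ⊇C (here refl) , λ E E∈T x∈E → resolve E (find (confined E∈T (lose x∈E refl))) x∈E
    where
    resolve : ∀ E → ∃[ F ] (F ∈ extClauses (x , p , q) × E ≋ F) → pos x ∈ E → TautRes C (neg x) E
    resolve E (_ , here refl , (E⊆ , _)) x∈E with E⊆ x∈E
    ... | there (here x≡p) = ⊥-elim (x≢p (cong var x≡p))
    resolve E (_ , there (here refl) , (E⊆ , _)) x∈E with E⊆ x∈E
    ... | there (here x≡q) = ⊥-elim (x≢q (cong var x≡q))
    resolve E (_ , there (there (here refl)) , (_ , ⊆E)) _ =
      tautRes-complementary l (⊇C (there (here refl)) , ≢-x x≢l refl)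
                              (⊆E (there l̄∈) , ≢-x (x≢~ l x≢l) refl)

  blocked-x∨p̄∨q̄ : ∀ {C T} → C ≋ (pos x ∷ ~ p ∷ ~ q ∷ []) → Confined T → Blocked C T
  blocked-x∨p̄∨q̄ {C} {T} (_ , ⊇C) confined =
    pos x , ⊇C (here refl) , λ E E∈T x̄∈E → resolve E (find (confined E∈T (lose x̄∈E refl))) x̄∈E
    where
    clash : ∀ {E l} → x ≢ var l → ~ l ∈ C → l ∈ E → TautRes C (pos x) E
    clash {E} {l} x≢l l̄∈C l∈E =
      tautRes-complementary (~ l) (l̄∈C , ≢-x (x≢~ l x≢l) refl)
        (subst (_∈ E) (sym (~-involutive l)) l∈E , subst (_≢ neg x) (sym (~-involutive l)) (≢-x x≢l refl))
    resolve : ∀ E → ∃[ F ] (F ∈ extClauses (x , p , q) × E ≋ F) → neg x ∈ E → TautRes C (pos x) E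
    resolve E (_ , here refl , (_ , ⊆E)) _ =
      clash x≢p (⊇C (there (here refl))) (⊆E (there (here refl)))
    resolve E (_ , there (here refl) , (_ , ⊆E)) _ =
      clash x≢q (⊇C (there (there (here refl)))) (⊆E (there (here refl)))
    resolve E (_ , there (there (here refl)) , (E⊆ , _)) x̄∈E with E⊆ x̄∈E
    ... | there (here x̄≡p̄)         = ⊥-elim (x≢~ p x≢p (cong var x̄≡p̄))
    ... | there (there (here x̄≡q̄)) = ⊥-elim (x≢~ q x≢q (cong var x̄≡q̄))

  blocked : ∀ {C T} → ⟦ extClauses (x , p , q) ⟧ C → Confined T → Blocked C T
  blocked C∈ with find C∈
  ... | _ , here refl , C≋                 = blocked-x̄∨l x≢p (here refl) C≋
  ... | _ , there (here refl) , C≋         = blocked-x̄∨l x≢q (there (here refl)) C≋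
  ... | _ , there (there (here refl)) , C≋ = blocked-x∨p̄∨q̄ C≋

  Confined-ins : ∀ {C T} → ⟦ extClauses (x , p , q) ⟧ C → Confined T → Confined (ins C T)
  Confined-ins C∈ confined (inj₁ E≋C) _   = Any.map (≋-trans E≋C) C∈
  Confined-ins C∈ confined (inj₂ E∈T) x∈E = confined E∈T x∈E

  blockedSeq : ∀ {S} → Confined S → BlockedSeq S (dedup (extClauses (x , p , q)))
  blockedSeq = BlockedSeq-invariant Confined blocked Confined-ins (dedup (extClauses (x , p , q)))
                 (All-dedup (extClauses (x , p , q)) (All.tabulate ∈⇒⟦⟧))

BlockedSeq-dedupExt : ∀ {Z : ℕ → Set} es {D S} → ValidExt D es → (∀ {t} → t ∈ es → ¬ Z (proj₁ t)) →
                      VarsWithin S (λ v → VarF D v ⊎ Z v) → BlockedSeq S (dedupExt es)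
BlockedSeq-dedupExt [] _ _ _ = tt
BlockedSeq-dedupExt {Z} ((x , p , q) ∷ es) {D} {S} ((x∉D , x≢p , x≢q , _) , valid) x∉Z vars =
  BlockedSeq-++ (dedup (extClauses (x , p , q))) (ExtensionTriple.blockedSeq x p q x≢p x≢q confined)
    λ S'⊆ → BlockedSeq-dedupExt es valid (λ t∈ → x∉Z (there t∈)) (vars' S'⊆)
  where
  confined : ExtensionTriple.Confined x p q x≢p x≢q S
  confined E∈S x∈E with vars E∈S x∈E
  ... | inj₁ x∈D = ⊥-elim (x∉D x∈D)
  ... | inj₂ Zx  = ⊥-elim (x∉Z (here refl) Zx)
  vars' : ∀ {S'} → S' ⊆ᶠ S ∪F ⟦ dedup (extClauses (x , p , q)) ⟧ →
          VarsWithin S' (λ v → VarF (D ∪F ⟦ extClauses (x , p , q) ⟧) v ⊎ Z v)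
  vars' S'⊆ E∈ v∈E with S'⊆ E∈
  ... | inj₂ E∈e = inj₁ (_ , inj₂ (⟦dedup⟧⁻ (extClauses (x , p , q)) E∈e) , v∈E)
  ... | inj₁ E∈S with vars E∈S v∈E
  ...   | inj₁ (C , C∈D , v∈C) = inj₁ (C , inj₁ C∈D , v∈C)
  ...   | inj₂ Zv              = inj₂ Zv

occ-⟦⟧ : ∀ {Γ E v} → ⟦ Γ ⟧ E → OccC v E → OccL v Γ
occ-⟦⟧ E∈ v∈E with find E∈
... | G , G∈ , (E⊆G , _) = lose G∈ (Any-resp-⊆ E⊆G v∈E)

OccL⇒VarF : ∀ {v Γ} → OccL v Γ → VarF ⟦ Γ ⟧ v
OccL⇒VarF v∈ with find v∈
... | G , G∈ , v∈G = G , ∈⇒⟦⟧ G∈ , v∈G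

OrF-∈ : ∀ {ℓ Γ E l} → OrF ℓ Γ E → l ∈ E → l ≡ ℓ ⊎ OccL (var l) Γ
OrF-∈ (D , D∈ , _ , (E⊆ , _)) l∈E with E⊆ l∈E
... | here l≡ℓ  = inj₁ l≡ℓ
... | there l∈D = inj₂ (lose D∈ (lose l∈D refl))

module Simulation (Γ : List Clause) (ext : List ExtTriple)
  (valid : ValidExt ⟦ Γ ⟧ ext) (extVarsOK : ExtVarsOK (λ v → OccL v Γ) ext)
  (m : ℕ) (y z : Fin (suc m) → ℕ)
  (y-injective : Injective _≡_ _≡_ y) (y≢z : ∀ i j → y i ≢ z j)
  (y-fresh : ∀ j → ¬ (OccL (y j) Γ ⊎ OccL (y j) (extAll ext)))
  (z-fresh : ∀ j → ¬ (OccL (z j) Γ ⊎ OccL (z j) (extAll ext))) where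

  I : Formula
  I = I-F Γ ext y z

  Λ : List Clause
  Λ = dedupExt ext

  YZ : ℕ → Set
  YZ v = ∃[ j ] (v ≡ y j ⊎ v ≡ z j)

  extVar∉YZ : ∀ {t} → t ∈ ext → ¬ YZ (proj₁ t)
  extVar∉YZ {x , _} t∈ (j , inj₁ refl) = y-fresh j (inj₂ (extVar-occurs ext t∈))
  extVar∉YZ {x , _} t∈ (j , inj₂ refl) = z-fresh j (inj₂ (extVar-occurs ext t∈))

  -- The extension variables occur in I only through V, so this is where m ≥ 1 is needed.
  extVar∈I : ∀ {t} → t ∈ ext → VarF I (proj₁ t)
  extVar∈I {x , _} t∈ = (pos x ∷ pos (y zero) ∷ neg (z zero) ∷ []) ,
    inj₂ (inj₁ (Any.map (λ { refl → zero , inj₁ ≋-refl }) t∈)) , here refl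

  occΓ⇒I : ∀ {v} → OccL v Γ → VarF I v
  occΓ⇒I v∈ with OccL⇒VarF v∈
  ... | G , G∈ , v∈G = G , inj₁ G∈ , v∈G

  occExt⇒I : ∀ {v} → OccL v (extAll ext) → VarF I v
  occExt⇒I = occ-extAll ext extVarsOK occΓ⇒I extVar∈I

  K : List Clause
  K = Γ ++ extAll ext

  Keep : Lit → Set
  Keep l = OccL (var l) K

  keep? : Decidable Keep
  keep? l = any? (λ C → any? (λ l' → var l' ≟ var l) C) K

  Keep-~ : ∀ l → Keep l → Keep (~ l)
  Keep-~ l = subst (λ v → OccL v K) (sym (var-~ l))

  open Restriction Keep keep? Keep-~

  restrict-member : ∀ {E G} → G ∈ K → E ≋ G → restrict E ≋ G
  restrict-member G∈K E≋G =
    ≋-trans (restrict-≋ E≋G) (restrict-id (All.tabulate λ l∈G → lose G∈K (lose l∈G refl)))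

  embeds : Embeds (⟦ Γ ⟧ ∪F ⟦ extAll ext ⟧) (I ∪F ⟦ Λ ⟧)
  embeds (inj₁ E∈Γ) with find E∈Γ
  ... | G , G∈ , E≋G = inj₁ (inj₁ (lose G∈ (restrict-member (Any.++⁺ˡ G∈) E≋G)))
  embeds (inj₂ E∈ext) with find E∈ext
  ... | F , F∈ , E≋F = inj₂ (⟦dedupExt⟧⁺ ext (lose F∈ (restrict-member (Any.++⁺ʳ Γ F∈) E≋F)))

  restrict-vars : ∀ R {v} → OccC v (restrict R) → VarF I v
  restrict-vars R v∈ with find v∈
  ... | l , l∈ , refl with Any.++⁻ Γ (proj₂ (∈-filter⁻ keep? {xs = R} l∈))
  ...   | inj₁ v∈Γ   = occΓ⇒I v∈Γ
  ...   | inj₂ v∈ext = occExt⇒I v∈ext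

  VClause : ℕ → Fin (suc m) → Clause → Set
  VClause x j C = (C ≋ (pos x ∷ pos (y j) ∷ neg (z j) ∷ [])) ⊎ (C ≋ (neg x ∷ pos (y j) ∷ neg (z j) ∷ []))

  VClause-lits : ∀ {x j C} → VClause x j C → pos (y j) ∈ C × neg (z j) ∈ C
  VClause-lits (inj₁ (_ , ⊆C)) = ⊆C (there (here refl)) , ⊆C (there (there (here refl)))
  VClause-lits (inj₂ (_ , ⊆C)) = ⊆C (there (here refl)) , ⊆C (there (there (here refl)))

  VClause-neg : ∀ {x j C v} → VClause x j C → neg v ∈ C → v ≡ x ⊎ v ≡ z j
  VClause-neg (inj₁ (C⊆ , _)) v̄∈C with C⊆ v̄∈C
  ... | there (there (here refl)) = inj₂ refl
  VClause-neg (inj₂ (C⊆ , _)) v̄∈C with C⊆ v̄∈C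
  ... | here refl                 = inj₁ refl
  ... | there (there (here refl)) = inj₂ refl

  V-view : ∀ es {C} → V-F es y z C → ∃[ t ] (t ∈ es × ∃[ j ] VClause (proj₁ t) j C)
  V-view ((x , _) ∷ es) (here (j , C≋))  = _ , here refl , j , C≋
  V-view (_ ∷ es)       (there C∈) with V-view es C∈
  ... | t , t∈ , j , C≋ = t , there t∈ , j , C≋

  V⇒y∧z̄ : ∀ {C} → V-F ext y z C → ∃[ j ] (pos (y j) ∈ C × neg (z j) ∈ C)
  V⇒y∧z̄ C∈V with V-view ext C∈V
  ... | _ , _ , j , C≋ = j , VClause-lits C≋

  V⇒ȳ∉ : ∀ {C} → V-F ext y z C → ∀ j → neg (y j) ∉ C
  V⇒ȳ∉ C∈V j ȳ∈C with V-view ext C∈V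
  ... | t , t∈ , j' , C≋ with VClause-neg C≋ ȳ∈C
  ...   | inj₁ y≡x = extVar∉YZ t∈ (j , inj₁ (sym y≡x))
  ...   | inj₂ y≡z = y≢z j j' y≡z

  vPair : ℕ → Fin (suc m) → List Clause
  vPair x j = (pos x ∷ pos (y j) ∷ neg (z j) ∷ []) ∷ (neg x ∷ pos (y j) ∷ neg (z j) ∷ []) ∷ []

  vClauses : ℕ → List Clause
  vClauses x = concatMap (vPair x) (allFin (suc m))

  vCandidates : List Clause
  vCandidates = concatMap (λ t → vClauses (proj₁ t)) ext

  vList : List Clause
  vList = dedup vCandidates

  ⟦vList⟧⁻ : ⟦ vList ⟧ ⊆ᶠ V-F ext y z
  ⟦vList⟧⁻ C∈ = go ext (⟦dedup⟧⁻ vCandidates C∈)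
    where
    go : ∀ es → ⟦ concatMap (λ t → vClauses (proj₁ t)) es ⟧ ⊆ᶠ V-F es y z
    go ((x , _) ∷ es) C∈ with Any.++⁻ (vClauses x) C∈
    ... | inj₂ C∈es = there (go es C∈es)
    ... | inj₁ C∈x with Any.satisfied (Any.concatMap⁻ (vPair x) {xs = allFin (suc m)} C∈x)
    ...   | j , here C≋         = here (j , inj₁ C≋)
    ...   | j , there (here C≋) = here (j , inj₂ C≋)

  ⟦vList⟧⁺ : V-F ext y z ⊆ᶠ ⟦ vList ⟧
  ⟦vList⟧⁺ C∈ = ⟦dedup⟧⁺ vCandidates (go ext C∈)
    where
    go : ∀ es → V-F es y z ⊆ᶠ ⟦ concatMap (λ t → vClauses (proj₁ t)) es ⟧
    go ((x , _) ∷ es) (here (j , C≋)) =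
      Any.++⁺ˡ (Any.concatMap⁺ (vPair x) (Any.map (λ { refl → shape C≋ }) (∈-allFin j)))
      where
      shape : ∀ {C} → VClause x j C → Any (C ≋_) (vPair x j)
      shape (inj₁ C≋) = here C≋
      shape (inj₂ C≋) = there (here C≋)
    go ((x , _) ∷ es) (there C∈) = Any.++⁺ʳ (vClauses x) (go es C∈)

  Γ' : Formula
  Γ' C = ⟦ Γ ⟧ C ⊎ W-F Γ y z C

  Γ'-lits : ∀ {E l} → Γ' E → l ∈ E → OccL (var l) Γ ⊎ YZ (var l)
  Γ'-lits (inj₁ E∈Γ) l∈E = inj₁ (occ-⟦⟧ E∈Γ (lose l∈E refl))
  Γ'-lits (inj₂ (j , inj₁ (E⊆ , _))) l∈E with E⊆ l∈E
  ... | here refl         = inj₂ (j , inj₁ refl)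
  ... | there (here refl) = inj₂ (j , inj₂ refl)
  Γ'-lits (inj₂ (j , inj₂ (inj₁ E∈yΓ))) l∈E with OrF-∈ E∈yΓ l∈E
  ... | inj₁ refl = inj₂ (j , inj₁ refl)
  ... | inj₂ l∈Γ  = inj₁ l∈Γ
  Γ'-lits (inj₂ (j , inj₂ (inj₂ E∈z̄Γ))) l∈E with OrF-∈ E∈z̄Γ l∈E
  ... | inj₁ refl = inj₂ (j , inj₂ refl)
  ... | inj₂ l∈Γ  = inj₁ l∈Γ

  Γ'-vars : VarsWithin Γ' (λ v → VarF ⟦ Γ ⟧ v ⊎ YZ v)
  Γ'-vars E∈ v∈E with find v∈E
  ... | l , l∈E , refl with Γ'-lits E∈ l∈E
  ...   | inj₁ l∈Γ = inj₁ (OccL⇒VarF l∈Γ)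
  ...   | inj₂ yz  = inj₂ yz

  V∉Γ' : ∀ {C} → V-F ext y z C → ¬ Γ' C
  V∉Γ' C∈V with V⇒y∧z̄ C∈V
  ... | j , y∈C , z̄∈C = excluded
    where
    excluded : ¬ Γ' _
    excluded (inj₁ C∈Γ) = y-fresh j (inj₁ (occ-⟦⟧ C∈Γ (lose y∈C refl)))
    excluded (inj₂ (j' , inj₁ (C⊆ , _))) with C⊆ y∈C
    ... | there (here y≡z) = y≢z j j' (cong var y≡z)
    excluded (inj₂ (j' , inj₂ (inj₁ C∈yΓ))) with OrF-∈ C∈yΓ z̄∈C
    ... | inj₂ z∈Γ = z-fresh j (inj₁ z∈Γ)
    excluded (inj₂ (j' , inj₂ (inj₂ C∈z̄Γ))) with OrF-∈ C∈z̄Γ y∈C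
    ... | inj₂ y∈Γ = y-fresh j (inj₁ y∈Γ)

  Guarded : Formula → Set
  Guarded T = ∀ {E} j → T E → neg (y j) ∈ E → pos (z j) ∈ E

  V-blocked : ∀ {C T} → V-F ext y z C → Guarded T → Blocked C T
  V-blocked C∈V guarded with V⇒y∧z̄ C∈V
  ... | j , y∈C , z̄∈C = pos (y j) , y∈C , λ E E∈T ȳ∈E →
    tautRes-complementary (neg (z j)) (z̄∈C , λ ()) (guarded j E∈T ȳ∈E , λ ())

  Guarded-ins : ∀ {C T} → V-F ext y z C → Guarded T → Guarded (ins C T)
  Guarded-ins C∈V guarded j (inj₁ (E⊆C , _)) ȳ∈E = ⊥-elim (V⇒ȳ∉ C∈V j (E⊆C ȳ∈E))
  Guarded-ins C∈V guarded j (inj₂ E∈T)        ȳ∈E = guarded j E∈T ȳ∈E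

  Γ'∪Λ-guarded : Guarded (Γ' ∪F ⟦ Λ ⟧)
  Γ'∪Λ-guarded j (inj₁ (inj₁ E∈Γ)) ȳ∈E = ⊥-elim (y-fresh j (inj₁ (occ-⟦⟧ E∈Γ (lose ȳ∈E refl))))
  Γ'∪Λ-guarded j (inj₁ (inj₂ (j' , inj₁ (E⊆ , ⊆E)))) ȳ∈E with E⊆ ȳ∈E
  ... | there (here ())
  ... | here ȳ≡ȳ' with y-injective (cong var ȳ≡ȳ')
  ...   | refl = ⊆E (there (here refl))
  Γ'∪Λ-guarded j (inj₁ (inj₂ (j' , inj₂ (inj₁ E∈yΓ)))) ȳ∈E with OrF-∈ E∈yΓ ȳ∈E
  ... | inj₂ y∈Γ = ⊥-elim (y-fresh j (inj₁ y∈Γ))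
  Γ'∪Λ-guarded j (inj₁ (inj₂ (j' , inj₂ (inj₂ E∈z̄Γ)))) ȳ∈E with OrF-∈ E∈z̄Γ ȳ∈E
  ... | inj₁ ȳ≡z̄ = ⊥-elim (y≢z j j' (cong var ȳ≡z̄))
  ... | inj₂ y∈Γ = ⊥-elim (y-fresh j (inj₁ y∈Γ))
  Γ'∪Λ-guarded j (inj₂ E∈Λ) ȳ∈E =
    ⊥-elim (y-fresh j (inj₂ (occ-⟦⟧ (⟦dedupExt⟧⁻ ext E∈Λ) (lose ȳ∈E refl))))

  blockedOrder : List Clause
  blockedOrder = Λ ++ vList

  blockedOrder-distinct : Distinct blockedOrder
  blockedOrder-distinct =
    AllPairs.++⁺ (dedupExt-distinct ext valid) (dedup-distinct vCandidates)
      (All.tabulate λ C∈Λ → All.tabulate λ D∈V C≋D →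
        let j , y∈D , _ = V⇒y∧z̄ (⟦vList⟧⁻ (∈⇒⟦⟧ D∈V))
        in y-fresh j (inj₂ (occ-⟦⟧ (⟦dedupExt⟧⁻ ext (∈⇒⟦⟧ C∈Λ)) (lose (proj₂ C≋D y∈D) refl))))

  blockedOrder-blocked : BlockedSeq Γ' blockedOrder
  blockedOrder-blocked =
    BlockedSeq-++ Λ (BlockedSeq-dedupExt ext valid extVar∉YZ Γ'-vars) λ S'⊆ →
      BlockedSeq-invariant Guarded V-blocked Guarded-ins vList
        (All-dedup vCandidates (All.tabulate (λ C∈ → ⟦vList⟧⁻ (⟦dedup⟧⁺ vCandidates (∈⇒⟦⟧ C∈)))))
        (λ j E∈ → Γ'∪Λ-guarded j (S'⊆ E∈))

  blockedOrder-members : ∀ C → ⟦ blockedOrder ⟧ C ⇔ (⟦ Λ ⟧ C ⊎ (I C × ¬ Γ' C))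
  blockedOrder-members C = mk⇔ to from
    where
    to : ⟦ blockedOrder ⟧ C → ⟦ Λ ⟧ C ⊎ (I C × ¬ Γ' C)
    to C∈ with Any.++⁻ Λ C∈
    ... | inj₁ C∈Λ = inj₁ C∈Λ
    ... | inj₂ C∈V = inj₂ (inj₂ (inj₁ (⟦vList⟧⁻ C∈V)) , V∉Γ' (⟦vList⟧⁻ C∈V))
    from : ⟦ Λ ⟧ C ⊎ (I C × ¬ Γ' C) → ⟦ blockedOrder ⟧ C
    from (inj₁ C∈Λ)                 = Any.++⁺ˡ C∈Λ
    from (inj₂ (inj₁ C∈Γ , C∉Γ'))        = ⊥-elim (C∉Γ' (inj₁ C∈Γ))
    from (inj₂ (inj₂ (inj₁ C∈V) , _))    = Any.++⁺ʳ Λ (⟦vList⟧⁺ C∈V)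
    from (inj₂ (inj₂ (inj₂ C∈W) , C∉Γ')) = ⊥-elim (C∉Γ' (inj₂ C∈W))

  Λ-blockedExt : BlockedExt I Λ
  Λ-blockedExt = Γ' , (λ { C (inj₁ C∈Γ) → inj₁ C∈Γ ; C (inj₂ C∈W) → inj₂ (inj₂ C∈W) }) ,
                 blockedOrder , blockedOrder-distinct , blockedOrder-members , blockedOrder-blocked

  gerProof : ResProof (⟦ Γ ⟧ ∪F ⟦ extAll ext ⟧) → GERminusProof I
  gerProof Π = record
    { Λ         = Λ
    ; Λclauses  = NonTaut-dedupExt ext valid
    ; Λdistinct = dedupExt-distinct ext valid
    ; blocked   = Λ-blockedExt
    ; proof     = restrict-proof embeds Π
    ; varsΛ     = λ C C∈Λ v v∈C → occExt⇒I (occ-⟦⟧ (⟦dedupExt⟧⁻ ext (∈⇒⟦⟧ C∈Λ)) v∈C)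
    ; varsΠ     = λ C C∈ v v∈C → varsΠ (∈-map⁻ restrict C∈) v∈C
    }
    where
    varsΠ : ∀ {C v} → ∃[ R ] (R ∈ ResProof.added Π × C ≡ restrict R) → OccC v C → VarF I v
    varsΠ (R , _ , refl) = restrict-vars R

  gerSize-gerProof : ∀ Π → gerSize (gerProof Π) ≤ 3 * length ext + resSize Π
  gerSize-gerProof Π =
    ℕ.+-mono-≤ (length-dedupExt ext) (ℕ.≤-reflexive (cong suc (length-map restrict (ResProof.added Π))))

lemma25 : (Γ : List Clause) → All NonTaut Γ → Unsatisfiable Γ →
          (P : ERProof Γ) → (∀ (P' : ERProof Γ) → erSize P ≤ erSize P') →
          ExtVarsOK (λ v → OccL v Γ) (ERProof.ext P) →
          (m : ℕ) → 1 ≤ m → (y z : Fin m → ℕ) →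
          Injective _≡_ _≡_ y → Injective _≡_ _≡_ z → (∀ i j → y i ≢ z j) →
          (∀ j → ¬ (OccL (y j) Γ ⊎ OccL (y j) (extAll (ERProof.ext P)))) →
          (∀ j → ¬ (OccL (z j) Γ ⊎ OccL (z j) (extAll (ERProof.ext P)))) →
          Σ (GERminusProof (I-F Γ (ERProof.ext P) y z)) (λ Q → gerSize Q ≤ erSize P)
lemma25 Γ _ _ P _ extVarsOK (suc m) _ y z y-injective _ y≢z y-fresh z-fresh =
  gerProof (ERProof.proof P) , gerSize-gerProof (ERProof.proof P)
  where
  open Simulation Γ (ERProof.ext P) (ERProof.extValid P) extVarsOK m y z y-injective y≢z y-fresh z-fresh
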